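{- For a partition $\pi$ of a positive integer, let $X(\pi)$ be the number of distinct even part sizes that occur in $\pi$, and let $Y(\pi)$ be the number of part sizes that occur in $\pi$ with multiplicity at least $2$ (i.e. repeated part sizes). Then $X$ and $Y$ are identically distributed: for every $n\ge 1$ and every $j\ge 0$, the number of partitions $\pi$ of $n$ with $X(\pi)=j$ equals the number of partitions $\pi$ of $n$ with $Y(\pi)=j$.
   Context: A partition of a positive integer $n$ is a finite multiset of positive integers (its parts) summing to $n$; ${\cal P}(n)$ denotes the set of partitions of $n$ and $p(n)=|{\cal P}(n)|$. A partition statistic is a nonnegative-integer-valued function on the set of all partitions of all positive integers. Two partition statistics $X,Y$ are identically distributed if for all $n\ge 1$ and $j\ge 0$, $|\{\pi\in{\cal P}(n):X(\pi)=j\}|=|\{\pi\in{\cal P}(n):Y(\pi)=j\}|$. -}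

module Defs where

open import Data.Nat using (ℕ; zero; suc; _≤_; _≥_; _≟_; _<_)
open import Data.Nat.Properties using (_≥?_; _<?_)
open import Data.List using (List; []; _∷_; length; filter; deduplicate)
open import Data.Nat.ListAction using (sum)
open import Data.List.Relation.Unary.All using (All)
open import Data.List.Relation.Unary.Linked using (Linked)
open import Data.Product using (Σ; _×_)
open import Relation.Binary.PropositionalEquality using (_≡_)
open import Relation.Nullary.Decidable using (¬?)
open import Data.Nat.Base using (_%_)

-- A partition of n: the multiset of parts is represented canonically as
-- the list of parts in weakly decreasing order, all parts positive,
-- summing to n.
record Partition (n : ℕ) : Set where
  constructor mkPartition
  field
    parts      : List ℕ
    decreasing : Linked _≥_ parts
    positive   : All (λ k → 0 < k) parts
    sums       : sum parts ≡ n

open Partition public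

distinctParts : List ℕ → List ℕ
distinctParts = deduplicate _≟_

multiplicity : ℕ → List ℕ → ℕ
multiplicity k xs = length (filter (k ≟_) xs)

X : ∀ {n} → Partition n → ℕ
X π = length (filter (λ k → (k % 2) ≟ 0) (distinctParts (parts π)))

Y : ∀ {n} → Partition n → ℕ
Y π = length (filter (λ k → multiplicity k (parts π) ≥? 2) (distinctParts (parts π)))

-- A partition is encoded by its multiplicity sequence. Glaisher's bijection (binary expansion
-- of multiplicities) turns the odd parts into distinct parts with the same sum; adding to these
-- two copies of k for every even part 2k gives a partition of the same number in which k is
-- repeated exactly when 2k was a part. Parities and halves of the new multiplicities recover the
-- distinct parts and the even parts, so this is a bijection carrying X to Y.

module Submission where

open import Defs
open import Data.Nat
  using (ℕ; NonZero; zero; suc; pred; _+_; _*_; _≤_; _<_; _≥_; z≤n; s≤s; s≤s⁻¹; _≟_; _%_; ⌊_/2⌋)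
open import Data.Nat.Properties
open import Data.Nat.DivMod using (m%n<n)
open import Data.Nat.Tactic.RingSolver using (solve-∀)
open import Data.Bool using (Bool; true; false; if_then_else_)
open import Data.List using (List; []; _∷_; foldr; map; _++_; replicate; length; filter)
open import Data.List.Properties
  using (∷-injective; ++-identityʳ; length-++; length-map; length-replicate; filter-++; filter-none; filter-all)
open import Data.Nat.ListAction using (sum)
open import Data.Nat.ListAction.Properties using (sum-++)
open import Data.List.Relation.Unary.All as All using (All; []; _∷_)
open import Data.List.Relation.Unary.All.Properties using (deduplicate⁺; map⁻; ++⁻ˡ; replicate⁺)
open import Data.List.Relation.Unary.Linked as Linked using (Linked; []; [-]; _∷_)
open import Data.List.Relation.Unary.Linked.Properties using (Linked⇒All)
open import Data.Product using (Σ; _,_; _×_; proj₁)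
open import Data.Product.Properties using (Σ-≡,≡→≡)
open import Relation.Binary.PropositionalEquality
open import Relation.Nullary using (Dec; does; ¬?; contradiction)
open import Function using (_∘_; flip)
open import Relation.Unary using (Pred; Decidable)
open import Level using (0ℓ)
open import Relation.Binary.Bundles using (Setoid)
import Relation.Binary.Reasoning.Setoid as SetoidReasoning
open import Function.Bundles using (_↔_; mk↔ₛ′)

-- Finitely supported sequences

-- A list stands for the sequence obtained by padding it with zeros; _≈_ is equality of sequences.
infixl 9 _‼_
_‼_ : List ℕ → ℕ → ℕ
[]       ‼ _     = 0
(x ∷ xs) ‼ zero  = x
(x ∷ xs) ‼ suc i = xs ‼ i

infix 4 _≈_
record _≈_ (xs ys : List ℕ) : Set where
  constructor mk≈
  field ‼-≡ : ∀ i → xs ‼ i ≡ ys ‼ i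
open _≈_

≈-refl : ∀ {xs} → xs ≈ xs
≈-refl = mk≈ λ _ → refl

≈-sym : ∀ {xs ys} → xs ≈ ys → ys ≈ xs
≈-sym e = mk≈ λ i → sym (‼-≡ e i)

≈-trans : ∀ {xs ys zs} → xs ≈ ys → ys ≈ zs → xs ≈ zs
≈-trans e f = mk≈ λ i → trans (‼-≡ e i) (‼-≡ f i)

≈-setoid : Setoid 0ℓ 0ℓ
≈-setoid = record
  { Carrier       = List ℕ
  ; _≈_           = _≈_
  ; isEquivalence = record { refl = ≈-refl ; sym = ≈-sym ; trans = ≈-trans }
  }

module ≈-Reasoning = SetoidReasoning ≈-setoid

≈-head : ∀ {x xs y ys} → x ∷ xs ≈ y ∷ ys → x ≡ y
≈-head e = ‼-≡ e 0

≈-tail : ∀ {x xs y ys} → x ∷ xs ≈ y ∷ ys → xs ≈ ys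
≈-tail e = mk≈ λ i → ‼-≡ e (suc i)

[]≈∷⇒ : ∀ {y ys} → [] ≈ y ∷ ys → 0 ≡ y × [] ≈ ys
[]≈∷⇒ e = ‼-≡ e 0 , mk≈ λ i → ‼-≡ e (suc i)

∷-≈ : ∀ {x y xs ys} → x ≡ y → xs ≈ ys → x ∷ xs ≈ y ∷ ys
∷-≈ x≡y e = mk≈ λ where
  zero    → x≡y
  (suc i) → ‼-≡ e i

[]≈∷ : ∀ {y ys} → 0 ≡ y → [] ≈ ys → [] ≈ y ∷ ys
[]≈∷ 0≡y e = mk≈ λ where
  zero    → 0≡y
  (suc i) → ‼-≡ e i

foldr-[]≈ : ∀ {B : Set} (_⊕_ : ℕ → B → B) {e} → 0 ⊕ e ≡ e →
            ∀ {ys} → [] ≈ ys → e ≡ foldr _⊕_ e ys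
foldr-[]≈ _⊕_ 0⊕e {[]}     _ = refl
foldr-[]≈ _⊕_ 0⊕e {y ∷ ys} e with []≈∷⇒ e
... | refl , e′ = trans (sym 0⊕e) (cong (0 ⊕_) (foldr-[]≈ _⊕_ 0⊕e e′))

foldr-≈ : ∀ {B : Set} (_⊕_ : ℕ → B → B) {e} → 0 ⊕ e ≡ e →
          ∀ {xs ys} → xs ≈ ys → foldr _⊕_ e xs ≡ foldr _⊕_ e ys
foldr-≈ _⊕_ 0⊕e {[]}     {ys}     e = foldr-[]≈ _⊕_ 0⊕e e
foldr-≈ _⊕_ 0⊕e {x ∷ xs} {[]}     e = sym (foldr-[]≈ _⊕_ 0⊕e (≈-sym e))
foldr-≈ _⊕_ 0⊕e {x ∷ xs} {y ∷ ys} e =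
  cong₂ _⊕_ (≈-head e) (foldr-≈ _⊕_ 0⊕e (≈-tail e))

sum-≈ : ∀ {xs ys} → xs ≈ ys → sum xs ≡ sum ys
sum-≈ = foldr-≈ _+_ refl

‼-map : ∀ {f : ℕ → ℕ} → f 0 ≡ 0 → ∀ xs i → map f xs ‼ i ≡ f (xs ‼ i)
‼-map f0 []       i       = sym f0
‼-map f0 (x ∷ xs) zero    = refl
‼-map f0 (x ∷ xs) (suc i) = ‼-map f0 xs i

map-≈ : ∀ {f : ℕ → ℕ} → f 0 ≡ 0 → ∀ {xs ys} → xs ≈ ys → map f xs ≈ map f ys
map-≈ {f} f0 {xs} {ys} e = mk≈ λ i → begin
  map f xs ‼ i  ≡⟨ ‼-map f0 xs i ⟩
  f (xs ‼ i)    ≡⟨ cong f (‼-≡ e i) ⟩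
  f (ys ‼ i)    ≡⟨ ‼-map f0 ys i ⟨
  map f ys ‼ i  ∎
  where open ≡-Reasoning

double : ℕ → ℕ
double zero    = zero
double (suc i) = suc (suc (double i))

double≡+ : ∀ i → double i ≡ i + i
double≡+ zero    = refl
double≡+ (suc i) = cong suc (trans (cong suc (double≡+ i)) (sym (+-suc i i)))

data EvenOdd : ℕ → Set where
  even : ∀ i → EvenOdd (double i)
  odd  : ∀ i → EvenOdd (suc (double i))

evenOdd : ∀ k → EvenOdd k
evenOdd zero = even 0
evenOdd (suc k) with evenOdd k
... | even i = odd i
... | odd i  = even (suc i)

evens odds : List ℕ → List ℕ
evens []       = []
evens (x ∷ xs) = x ∷ odds xs
odds []       = []
odds (x ∷ xs) = evens xs

‼-evens : ∀ xs i → evens xs ‼ i ≡ xs ‼ double i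
‼-odds  : ∀ xs i → odds xs ‼ i ≡ xs ‼ suc (double i)
‼-evens []       i       = refl
‼-evens (x ∷ xs) zero    = refl
‼-evens (x ∷ xs) (suc i) = ‼-odds xs i
‼-odds []       i = refl
‼-odds (x ∷ xs) i = ‼-evens xs i

interleave : List ℕ → List ℕ → List ℕ
interleave []       []       = []
interleave []       (b ∷ bs) = 0 ∷ b ∷ interleave [] bs
interleave (a ∷ as) []       = a ∷ 0 ∷ interleave as []
interleave (a ∷ as) (b ∷ bs) = a ∷ b ∷ interleave as bs

‼-interleave-even : ∀ as bs i → interleave as bs ‼ double i ≡ as ‼ i
‼-interleave-even []       []       i       = refl
‼-interleave-even []       (b ∷ bs) zero    = refl
‼-interleave-even []       (b ∷ bs) (suc i) = ‼-interleave-even [] bs i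
‼-interleave-even (a ∷ as) []       zero    = refl
‼-interleave-even (a ∷ as) []       (suc i) = ‼-interleave-even as [] i
‼-interleave-even (a ∷ as) (b ∷ bs) zero    = refl
‼-interleave-even (a ∷ as) (b ∷ bs) (suc i) = ‼-interleave-even as bs i

‼-interleave-odd : ∀ as bs i → interleave as bs ‼ suc (double i) ≡ bs ‼ i
‼-interleave-odd []       []       i       = refl
‼-interleave-odd []       (b ∷ bs) zero    = refl
‼-interleave-odd []       (b ∷ bs) (suc i) = ‼-interleave-odd [] bs i
‼-interleave-odd (a ∷ as) []       zero    = refl
‼-interleave-odd (a ∷ as) []       (suc i) = ‼-interleave-odd as [] i
‼-interleave-odd (a ∷ as) (b ∷ bs) zero    = refl
‼-interleave-odd (a ∷ as) (b ∷ bs) (suc i) = ‼-interleave-odd as bs i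

≈-byParity : ∀ {xs ys : List ℕ} → (∀ i → xs ‼ double i ≡ ys ‼ double i) →
             (∀ i → xs ‼ suc (double i) ≡ ys ‼ suc (double i)) → xs ≈ ys
≈-byParity {xs} {ys} e o = mk≈ λ k → by-parity k (evenOdd k)
  where
  by-parity : ∀ k → EvenOdd k → xs ‼ k ≡ ys ‼ k
  by-parity _ (even i) = e i
  by-parity _ (odd i)  = o i

evens-≈ : ∀ {xs ys} → xs ≈ ys → evens xs ≈ evens ys
evens-≈ {xs} {ys} e = mk≈ λ i → trans (‼-evens xs i) (trans (‼-≡ e _) (sym (‼-evens ys i)))

odds-≈ : ∀ {xs ys} → xs ≈ ys → odds xs ≈ odds ys
odds-≈ {xs} {ys} e = mk≈ λ i → trans (‼-odds xs i) (trans (‼-≡ e _) (sym (‼-odds ys i)))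

interleave-≈ : ∀ {as as′ bs bs′} → as ≈ as′ → bs ≈ bs′ →
               interleave as bs ≈ interleave as′ bs′
interleave-≈ {as} {as′} {bs} {bs′} ea eb = ≈-byParity
  (λ i → trans (‼-interleave-even as bs i) (trans (‼-≡ ea i) (sym (‼-interleave-even as′ bs′ i))))
  (λ i → trans (‼-interleave-odd as bs i) (trans (‼-≡ eb i) (sym (‼-interleave-odd as′ bs′ i))))

evens-interleave : ∀ as bs → evens (interleave as bs) ≈ as
evens-interleave as bs = mk≈ λ i → trans (‼-evens (interleave as bs) i) (‼-interleave-even as bs i)

odds-interleave : ∀ as bs → odds (interleave as bs) ≈ bs
odds-interleave as bs = mk≈ λ i → trans (‼-odds (interleave as bs) i) (‼-interleave-odd as bs i)

interleave-evens-odds : ∀ xs → interleave (evens xs) (odds xs) ≈ xs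
interleave-evens-odds xs = ≈-byParity
  (λ i → trans (‼-interleave-even (evens xs) (odds xs) i) (‼-evens xs i))
  (λ i → trans (‼-interleave-odd (evens xs) (odds xs) i) (‼-odds xs i))

addTwice : List ℕ → List ℕ → List ℕ
addTwice []       bs       = map double bs
addTwice (a ∷ as) []       = a ∷ as
addTwice (a ∷ as) (b ∷ bs) = a + double b ∷ addTwice as bs

‼-addTwice : ∀ as bs i → addTwice as bs ‼ i ≡ as ‼ i + double (bs ‼ i)
‼-addTwice []       bs       i       = ‼-map refl bs i
‼-addTwice (a ∷ as) []       zero    = sym (+-identityʳ a)
‼-addTwice (a ∷ as) []       (suc i) = sym (+-identityʳ (as ‼ i))
‼-addTwice (a ∷ as) (b ∷ bs) zero    = refl
‼-addTwice (a ∷ as) (b ∷ bs) (suc i) = ‼-addTwice as bs i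

addTwice-≈ : ∀ {as as′ bs bs′} → as ≈ as′ → bs ≈ bs′ → addTwice as bs ≈ addTwice as′ bs′
addTwice-≈ {as} {as′} {bs} {bs′} ea eb = mk≈ λ i → begin
  addTwice as bs ‼ i          ≡⟨ ‼-addTwice as bs i ⟩
  as ‼ i + double (bs ‼ i)    ≡⟨ cong₂ (λ a b → a + double b) (‼-≡ ea i) (‼-≡ eb i) ⟩
  as′ ‼ i + double (bs′ ‼ i)  ≡⟨ ‼-addTwice as′ bs′ i ⟨
  addTwice as′ bs′ ‼ i        ∎
  where open ≡-Reasoning

%2+double⌊/2⌋ : ∀ n → n % 2 + double ⌊ n /2⌋ ≡ n
%2+double⌊/2⌋ zero          = refl
%2+double⌊/2⌋ (suc zero)    = refl
%2+double⌊/2⌋ (suc (suc n)) = begin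
  n % 2 + suc (suc (double ⌊ n /2⌋))  ≡⟨ +-suc (n % 2) _ ⟩
  suc (n % 2 + suc (double ⌊ n /2⌋))  ≡⟨ cong suc (+-suc (n % 2) _) ⟩
  suc (suc (n % 2 + double ⌊ n /2⌋))  ≡⟨ cong (suc ∘ suc) (%2+double⌊/2⌋ n) ⟩
  suc (suc n)                          ∎
  where open ≡-Reasoning

n%2≤1 : ∀ n → n % 2 ≤ 1
n%2≤1 n = s≤s⁻¹ (m%n<n n 2)

[b+double-c]%2≡b : ∀ b c → b ≤ 1 → (b + double c) % 2 ≡ b
[b+double-c]%2≡b zero       zero    _ = refl
[b+double-c]%2≡b zero       (suc c) _ = [b+double-c]%2≡b zero c z≤n
[b+double-c]%2≡b (suc zero) zero    _ = refl
[b+double-c]%2≡b (suc zero) (suc c) _ = [b+double-c]%2≡b 1 c (s≤s z≤n)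
[b+double-c]%2≡b (suc (suc b)) c (s≤s ())

⌊[b+double-c]/2⌋≡c : ∀ b c → b ≤ 1 → ⌊ b + double c /2⌋ ≡ c
⌊[b+double-c]/2⌋≡c zero       zero    _ = refl
⌊[b+double-c]/2⌋≡c zero       (suc c) _ = cong suc (⌊[b+double-c]/2⌋≡c zero c z≤n)
⌊[b+double-c]/2⌋≡c (suc zero) zero    _ = refl
⌊[b+double-c]/2⌋≡c (suc zero) (suc c) _ = cong suc (⌊[b+double-c]/2⌋≡c 1 c (s≤s z≤n))
⌊[b+double-c]/2⌋≡c (suc (suc b)) c (s≤s ())

Bits : List ℕ → Set
Bits xs = ∀ i → xs ‼ i ≤ 1

%2-bits : ∀ z → Bits (map (_% 2) z)
%2-bits z i = subst (_≤ 1) (sym (‼-map refl z i)) (n%2≤1 (z ‼ i))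

addTwice-%2-⌊/2⌋ : ∀ xs → addTwice (map (_% 2) xs) (map ⌊_/2⌋ xs) ≈ xs
addTwice-%2-⌊/2⌋ xs = mk≈ λ i → begin
  addTwice (map (_% 2) xs) (map ⌊_/2⌋ xs) ‼ i
    ≡⟨ ‼-addTwice (map (_% 2) xs) (map ⌊_/2⌋ xs) i ⟩
  map (_% 2) xs ‼ i + double (map ⌊_/2⌋ xs ‼ i)
    ≡⟨ cong₂ (λ a b → a + double b) (‼-map refl xs i) (‼-map refl xs i) ⟩
  xs ‼ i % 2 + double ⌊ xs ‼ i /2⌋
    ≡⟨ %2+double⌊/2⌋ (xs ‼ i) ⟩
  xs ‼ i
    ∎
  where open ≡-Reasoning

%2-addTwice : ∀ bs cs → Bits bs → map (_% 2) (addTwice bs cs) ≈ bs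
%2-addTwice bs cs b = mk≈ λ i →
  trans (‼-map refl (addTwice bs cs) i)
        (trans (cong (_% 2) (‼-addTwice bs cs i)) ([b+double-c]%2≡b _ _ (b i)))

⌊/2⌋-addTwice : ∀ bs cs → Bits bs → map ⌊_/2⌋ (addTwice bs cs) ≈ cs
⌊/2⌋-addTwice bs cs b = mk≈ λ i →
  trans (‼-map refl (addTwice bs cs) i)
        (trans (cong ⌊_/2⌋ (‼-addTwice bs cs i)) (⌊[b+double-c]/2⌋≡c _ _ (b i)))

-- Sizes

-- weighted s d xs = Σᵢ (s + i·d)·xᵢ. If xᵢ counts the parts i + 1, size xs is the number
-- partitioned; if cᵢ counts the odd parts 2i + 1, so is oddSize cs.
weighted : ℕ → ℕ → List ℕ → ℕ
weighted s d []       = 0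
weighted s d (x ∷ xs) = s * x + weighted (s + d) d xs

size oddSize : List ℕ → ℕ
size    = weighted 1 1
oddSize = weighted 1 2

weighted-evens-odds : ∀ s d xs →
  weighted s d xs ≡ weighted s (d + d) (evens xs) + weighted (s + d) (d + d) (odds xs)
weighted-evens-odds s d []       = refl
weighted-evens-odds s d (x ∷ xs) = begin
  s * x + weighted (s + d) d xs
    ≡⟨ cong (s * x +_) (weighted-evens-odds (s + d) d xs) ⟩
  s * x + (weighted (s + d) (d + d) (evens xs) + weighted (s + d + d) (d + d) (odds xs))
    ≡⟨ cong (λ t → s * x + (weighted (s + d) (d + d) (evens xs) + weighted t (d + d) (odds xs)))
            (+-assoc s d d) ⟩
  s * x + (weighted (s + d) (d + d) (evens xs) + weighted (s + (d + d)) (d + d) (odds xs))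
    ≡⟨ swap (s * x) _ _ ⟩
  s * x + weighted (s + (d + d)) (d + d) (odds xs) + weighted (s + d) (d + d) (evens xs)
    ∎
  where
  open ≡-Reasoning
  swap : ∀ a b c → a + (b + c) ≡ a + c + b
  swap = solve-∀

weighted-double : ∀ s d xs → weighted (s + s) (d + d) xs ≡ weighted s d xs + weighted s d xs
weighted-double s d []       = refl
weighted-double s d (x ∷ xs) = begin
  (s + s) * x + weighted (s + s + (d + d)) (d + d) xs
    ≡⟨ cong (λ t → (s + s) * x + weighted t (d + d) xs) (regroup s d) ⟩
  (s + s) * x + weighted ((s + d) + (s + d)) (d + d) xs
    ≡⟨ cong ((s + s) * x +_) (weighted-double (s + d) d xs) ⟩
  (s + s) * x + (weighted (s + d) d xs + weighted (s + d) d xs)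
    ≡⟨ distribute s x (weighted (s + d) d xs) ⟩
  s * x + weighted (s + d) d xs + (s * x + weighted (s + d) d xs)
    ∎
  where
  open ≡-Reasoning
  regroup : ∀ s d → s + s + (d + d) ≡ s + d + (s + d)
  regroup = solve-∀
  distribute : ∀ s x w → (s + s) * x + (w + w) ≡ s * x + w + (s * x + w)
  distribute = solve-∀

weighted-addTwice : ∀ s d as bs →
  weighted s d (addTwice as bs) ≡ weighted s d as + (weighted s d bs + weighted s d bs)
weighted-addTwice s d []       bs       = weighted-map-double s d bs
  where
  weighted-map-double : ∀ s d bs → weighted s d (map double bs) ≡ weighted s d bs + weighted s d bs
  weighted-map-double s d []       = refl
  weighted-map-double s d (b ∷ bs) = begin
    s * double b + weighted (s + d) d (map double bs)
      ≡⟨ cong₂ (λ u v → s * u + v) (double≡+ b) (weighted-map-double (s + d) d bs) ⟩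
    s * (b + b) + (weighted (s + d) d bs + weighted (s + d) d bs)
      ≡⟨ distribute s b _ ⟩
    s * b + weighted (s + d) d bs + (s * b + weighted (s + d) d bs)
      ∎
    where
    open ≡-Reasoning
    distribute : ∀ s b w → s * (b + b) + (w + w) ≡ s * b + w + (s * b + w)
    distribute = solve-∀
weighted-addTwice s d (a ∷ as) []       = sym (+-identityʳ _)
weighted-addTwice s d (a ∷ as) (b ∷ bs) = begin
  s * (a + double b) + weighted (s + d) d (addTwice as bs)
    ≡⟨ cong₂ (λ u v → s * (a + u) + v) (double≡+ b) (weighted-addTwice (s + d) d as bs) ⟩
  s * (a + (b + b)) + (wa + (wb + wb))
    ≡⟨ distribute s a b wa wb ⟩
  s * a + wa + ((s * b + wb) + (s * b + wb))
    ∎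
  where
  open ≡-Reasoning
  wa = weighted (s + d) d as
  wb = weighted (s + d) d bs
  distribute : ∀ s a b A B → s * (a + (b + b)) + (A + (B + B)) ≡ s * a + A + ((s * b + B) + (s * b + B))
  distribute = solve-∀

weighted-[]≈ : ∀ s d {ys} → [] ≈ ys → 0 ≡ weighted s d ys
weighted-[]≈ s d {[]}     e = refl
weighted-[]≈ s d {y ∷ ys} e with []≈∷⇒ e
... | refl , e′ = cong₂ _+_ (sym (*-zeroʳ s)) (weighted-[]≈ (s + d) d e′)

weighted-≈ : ∀ s d {xs ys} → xs ≈ ys → weighted s d xs ≡ weighted s d ys
weighted-≈ s d {[]}     {ys}     e = weighted-[]≈ s d e
weighted-≈ s d {x ∷ xs} {[]}     e = sym (weighted-[]≈ s d (≈-sym e))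
weighted-≈ s d {x ∷ xs} {y ∷ ys} e =
  cong₂ _+_ (cong (s *_) (≈-head e)) (weighted-≈ (s + d) d (≈-tail e))

weighted-%2-⌊/2⌋ : ∀ s d xs →
  weighted s d (map (_% 2) xs) + (weighted s d (map ⌊_/2⌋ xs) + weighted s d (map ⌊_/2⌋ xs))
  ≡ weighted s d xs
weighted-%2-⌊/2⌋ s d xs = trans (sym (weighted-addTwice s d (map (_% 2) xs) (map ⌊_/2⌋ xs)))
                               (weighted-≈ s d (addTwice-%2-⌊/2⌋ xs))

weighted≡0⇒≈[] : ∀ s d xs → weighted (suc s) d xs ≡ 0 → [] ≈ xs
weighted≡0⇒≈[] s d []       _ = ≈-refl
weighted≡0⇒≈[] s d (x ∷ xs) w≡0 = mk≈ λ where
    zero    → sym (m+n≡0⇒m≡0 x (m+n≡0⇒m≡0 (suc s * x) w≡0))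
    (suc i) → ‼-≡ (weighted≡0⇒≈[] (s + d) d xs (m+n≡0⇒n≡0 (suc s * x) w≡0)) i

weighted-suc : ∀ s d xs → weighted (suc s) d xs ≡ weighted s d xs + sum xs
weighted-suc s d []       = refl
weighted-suc s d (x ∷ xs) = begin
  suc s * x + weighted (suc s + d) d xs     ≡⟨ cong (suc s * x +_) (weighted-suc (s + d) d xs) ⟩
  suc s * x + (weighted (s + d) d xs + sum xs)  ≡⟨ regroup s x (weighted (s + d) d xs) (sum xs) ⟩
  s * x + weighted (s + d) d xs + (x + sum xs)  ∎
  where
  open ≡-Reasoning
  regroup : ∀ s x w t → suc s * x + (w + t) ≡ s * x + w + (x + t)
  regroup = solve-∀

size-evens-odds : ∀ xs → size xs ≡ oddSize (evens xs) + (size (odds xs) + size (odds xs))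
size-evens-odds xs =
  trans (weighted-evens-odds 1 1 xs) (cong (oddSize (evens xs) +_) (weighted-double 1 1 (odds xs)))

size-interleave : ∀ as bs → size (interleave as bs) ≡ oddSize as + (size bs + size bs)
size-interleave as bs = trans (size-evens-odds (interleave as bs))
  (cong₂ (λ u v → u + (v + v)) (weighted-≈ 1 2 (evens-interleave as bs))
                               (weighted-≈ 1 1 (odds-interleave as bs)))

double≤suc⇒≤ : ∀ a w n → a + (w + w) ≤ suc n → w ≤ n
double≤suc⇒≤ a zero    n _ = z≤n
double≤suc⇒≤ a (suc w) n h =
  ≤-trans (m≤n+m (suc w) w) (s≤s⁻¹ (≤-trans (m≤n+m (suc w + suc w) a) h))

oddSize-⌊/2⌋≤ : ∀ {n} cs → oddSize cs ≤ suc n → oddSize (map ⌊_/2⌋ cs) ≤ n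
oddSize-⌊/2⌋≤ {n} cs h = double≤suc⇒≤ (oddSize (map (_% 2) cs)) _ n
  (subst (_≤ suc n) (sym (weighted-%2-⌊/2⌋ 1 2 cs)) h)

size-odds≤ : ∀ {n} bs → size bs ≤ suc n → size (odds bs) ≤ n
size-odds≤ {n} bs h = double≤suc⇒≤ (oddSize (evens bs)) _ n (subst (_≤ suc n) (size-evens-odds bs) h)

-- Glaisher's bijection

-- From the multiplicities cᵢ of the odd parts 2i + 1 to a 0/1 multiplicity sequence: 2ᵃ(2i + 1)
-- is a part iff bit a of cᵢ is set. The fuel n only has to bound the size, which halves at
-- every recursive call.
glaisher : ℕ → List ℕ → List ℕ
glaisher zero    cs = []
glaisher (suc n) cs = interleave (map (_% 2) cs) (glaisher n (map ⌊_/2⌋ cs))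

glaisher⁻¹ : ℕ → List ℕ → List ℕ
glaisher⁻¹ zero    bs = []
glaisher⁻¹ (suc n) bs = addTwice (evens bs) (glaisher⁻¹ n (odds bs))

glaisher-≈ : ∀ n {cs cs′} → cs ≈ cs′ → glaisher n cs ≈ glaisher n cs′
glaisher-≈ zero    e = ≈-refl
glaisher-≈ (suc n) e = interleave-≈ (map-≈ refl e) (glaisher-≈ n (map-≈ refl e))

glaisher⁻¹-≈ : ∀ n {bs bs′} → bs ≈ bs′ → glaisher⁻¹ n bs ≈ glaisher⁻¹ n bs′
glaisher⁻¹-≈ zero    e = ≈-refl
glaisher⁻¹-≈ (suc n) e = addTwice-≈ (evens-≈ e) (glaisher⁻¹-≈ n (odds-≈ e))

glaisher-bits : ∀ n cs → Bits (glaisher n cs)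
glaisher-bits zero    cs i = z≤n
glaisher-bits (suc n) cs k = bit k (evenOdd k)
  where
  bit : ∀ k → EvenOdd k → glaisher (suc n) cs ‼ k ≤ 1
  bit _ (even i) = subst (_≤ 1) (sym (‼-interleave-even (map (_% 2) cs) _ i)) (%2-bits cs i)
  bit _ (odd i)  = subst (_≤ 1) (sym (‼-interleave-odd (map (_% 2) cs) _ i))
                         (glaisher-bits n (map ⌊_/2⌋ cs) i)

evens-bits : ∀ {bs} → Bits bs → Bits (evens bs)
evens-bits {bs} b i = subst (_≤ 1) (sym (‼-evens bs i)) (b _)

odds-bits : ∀ {bs} → Bits bs → Bits (odds bs)
odds-bits {bs} b i = subst (_≤ 1) (sym (‼-odds bs i)) (b _)

size-glaisher : ∀ n cs → oddSize cs ≤ n → size (glaisher n cs) ≡ oddSize cs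
size-glaisher zero    cs h = sym (n≤0⇒n≡0 h)
size-glaisher (suc n) cs h = begin
  size (interleave (map (_% 2) cs) (glaisher n (map ⌊_/2⌋ cs)))
    ≡⟨ size-interleave (map (_% 2) cs) _ ⟩
  oddSize (map (_% 2) cs) + (size (glaisher n (map ⌊_/2⌋ cs)) + size (glaisher n (map ⌊_/2⌋ cs)))
    ≡⟨ cong (λ w → oddSize (map (_% 2) cs) + (w + w))
            (size-glaisher n (map ⌊_/2⌋ cs) (oddSize-⌊/2⌋≤ cs h)) ⟩
  oddSize (map (_% 2) cs) + (oddSize (map ⌊_/2⌋ cs) + oddSize (map ⌊_/2⌋ cs))
    ≡⟨ weighted-%2-⌊/2⌋ 1 2 cs ⟩
  oddSize cs
    ∎
  where open ≡-Reasoning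

oddSize-glaisher⁻¹ : ∀ n bs → size bs ≤ n → oddSize (glaisher⁻¹ n bs) ≡ size bs
oddSize-glaisher⁻¹ zero    bs h = sym (n≤0⇒n≡0 h)
oddSize-glaisher⁻¹ (suc n) bs h = begin
  oddSize (addTwice (evens bs) (glaisher⁻¹ n (odds bs)))
    ≡⟨ weighted-addTwice 1 2 (evens bs) _ ⟩
  oddSize (evens bs) + (oddSize (glaisher⁻¹ n (odds bs)) + oddSize (glaisher⁻¹ n (odds bs)))
    ≡⟨ cong (λ w → oddSize (evens bs) + (w + w)) (oddSize-glaisher⁻¹ n (odds bs) (size-odds≤ bs h)) ⟩
  oddSize (evens bs) + (size (odds bs) + size (odds bs))
    ≡⟨ size-evens-odds bs ⟨
  size bs
    ∎
  where open ≡-Reasoning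

glaisher-glaisher⁻¹ : ∀ n {bs} → Bits bs → size bs ≤ n → glaisher n (glaisher⁻¹ n bs) ≈ bs
glaisher-glaisher⁻¹ zero    {bs} b h = weighted≡0⇒≈[] 0 1 bs (n≤0⇒n≡0 h)
glaisher-glaisher⁻¹ (suc n) {bs} b h = begin
  interleave (map (_% 2) (addTwice E R)) (glaisher n (map ⌊_/2⌋ (addTwice E R)))
    ≈⟨ interleave-≈ (%2-addTwice E R E-bits) (glaisher-≈ n (⌊/2⌋-addTwice E R E-bits)) ⟩
  interleave E (glaisher n R)
    ≈⟨ interleave-≈ (≈-refl {E}) (glaisher-glaisher⁻¹ n (odds-bits {bs} b) (size-odds≤ bs h)) ⟩
  interleave E (odds bs)
    ≈⟨ interleave-evens-odds bs ⟩
  bs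
    ∎
  where
  open ≈-Reasoning
  E = evens bs
  E-bits = evens-bits {bs} b
  R = glaisher⁻¹ n (odds bs)

glaisher⁻¹-glaisher : ∀ n {cs} → oddSize cs ≤ n → glaisher⁻¹ n (glaisher n cs) ≈ cs
glaisher⁻¹-glaisher zero    {cs} h = weighted≡0⇒≈[] 0 2 cs (n≤0⇒n≡0 h)
glaisher⁻¹-glaisher (suc n) {cs} h = begin
  addTwice (evens (interleave P G)) (glaisher⁻¹ n (odds (interleave P G)))
    ≈⟨ addTwice-≈ (evens-interleave P G) (glaisher⁻¹-≈ n (odds-interleave P G)) ⟩
  addTwice P (glaisher⁻¹ n G)
    ≈⟨ addTwice-≈ (≈-refl {P}) (glaisher⁻¹-glaisher n (oddSize-⌊/2⌋≤ cs h)) ⟩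
  addTwice P (map ⌊_/2⌋ cs)
    ≈⟨ addTwice-%2-⌊/2⌋ cs ⟩
  cs
    ∎
  where
  open ≈-Reasoning
  P = map (_% 2) cs
  G = glaisher n (map ⌊_/2⌋ cs)

-- Entry i of a multiplicity sequence counts the parts equal to i + 1, so evens z holds the
-- multiplicities of the odd parts and odds z those of the even parts.
splitEvens mergePairs : ℕ → List ℕ → List ℕ
splitEvens n z = addTwice (glaisher n (evens z)) (odds z)
mergePairs n z = interleave (glaisher⁻¹ n (map (_% 2) z)) (map ⌊_/2⌋ z)

splitEvens-≈ : ∀ n {z z′} → z ≈ z′ → splitEvens n z ≈ splitEvens n z′
splitEvens-≈ n e = addTwice-≈ (glaisher-≈ n (evens-≈ e)) (odds-≈ e)

mergePairs-≈ : ∀ n {z z′} → z ≈ z′ → mergePairs n z ≈ mergePairs n z′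
mergePairs-≈ n e = interleave-≈ (glaisher⁻¹-≈ n (map-≈ refl e)) (map-≈ refl e)

oddSize-evens≤size : ∀ z → oddSize (evens z) ≤ size z
oddSize-evens≤size z = subst (oddSize (evens z) ≤_) (sym (size-evens-odds z)) (m≤m+n _ _)

size-%2≤size : ∀ z → size (map (_% 2) z) ≤ size z
size-%2≤size z = subst (size (map (_% 2) z) ≤_) (weighted-%2-⌊/2⌋ 1 1 z) (m≤m+n _ _)

size-splitEvens : ∀ n z → size z ≡ n → size (splitEvens n z) ≡ n
size-splitEvens n z refl = begin
  size (addTwice (glaisher (size z) (evens z)) (odds z))
    ≡⟨ weighted-addTwice 1 1 (glaisher (size z) (evens z)) (odds z) ⟩
  size (glaisher (size z) (evens z)) + (size (odds z) + size (odds z))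
    ≡⟨ cong (_+ (size (odds z) + size (odds z)))
            (size-glaisher (size z) (evens z) (oddSize-evens≤size z)) ⟩
  oddSize (evens z) + (size (odds z) + size (odds z))
    ≡⟨ size-evens-odds z ⟨
  size z
    ∎
  where open ≡-Reasoning

size-mergePairs : ∀ n z → size z ≡ n → size (mergePairs n z) ≡ n
size-mergePairs n z refl = begin
  size (interleave (glaisher⁻¹ (size z) (map (_% 2) z)) (map ⌊_/2⌋ z))
    ≡⟨ size-interleave (glaisher⁻¹ (size z) (map (_% 2) z)) (map ⌊_/2⌋ z) ⟩
  oddSize (glaisher⁻¹ (size z) (map (_% 2) z)) + (size (map ⌊_/2⌋ z) + size (map ⌊_/2⌋ z))
    ≡⟨ cong (_+ (size (map ⌊_/2⌋ z) + size (map ⌊_/2⌋ z)))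
            (oddSize-glaisher⁻¹ (size z) (map (_% 2) z) (size-%2≤size z)) ⟩
  size (map (_% 2) z) + (size (map ⌊_/2⌋ z) + size (map ⌊_/2⌋ z))
    ≡⟨ weighted-%2-⌊/2⌋ 1 1 z ⟩
  size z
    ∎
  where open ≡-Reasoning

splitEvens-mergePairs : ∀ n z → size z ≤ n → splitEvens n (mergePairs n z) ≈ z
splitEvens-mergePairs n z h = begin
  addTwice (glaisher n (evens (interleave B H))) (odds (interleave B H))
    ≈⟨ addTwice-≈ (glaisher-≈ n (evens-interleave B H)) (odds-interleave B H) ⟩
  addTwice (glaisher n B) H
    ≈⟨ addTwice-≈ (glaisher-glaisher⁻¹ n (%2-bits z) (≤-trans (size-%2≤size z) h)) (≈-refl {H}) ⟩
  addTwice (map (_% 2) z) H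
    ≈⟨ addTwice-%2-⌊/2⌋ z ⟩
  z
    ∎
  where
  open ≈-Reasoning
  B = glaisher⁻¹ n (map (_% 2) z)
  H = map ⌊_/2⌋ z

mergePairs-splitEvens : ∀ n z → size z ≤ n → mergePairs n (splitEvens n z) ≈ z
mergePairs-splitEvens n z h = begin
  interleave (glaisher⁻¹ n (map (_% 2) (addTwice D (odds z)))) (map ⌊_/2⌋ (addTwice D (odds z)))
    ≈⟨ interleave-≈ (glaisher⁻¹-≈ n (%2-addTwice D (odds z) D-bits)) (⌊/2⌋-addTwice D (odds z) D-bits) ⟩
  interleave (glaisher⁻¹ n D) (odds z)
    ≈⟨ interleave-≈ (glaisher⁻¹-glaisher n (≤-trans (oddSize-evens≤size z) h)) (≈-refl {odds z}) ⟩
  interleave (evens z) (odds z)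
    ≈⟨ interleave-evens-odds z ⟩
  z
    ∎
  where
  open ≈-Reasoning
  D = glaisher n (evens z)
  D-bits = glaisher-bits n (evens z)

signum : ℕ → ℕ
signum zero    = 0
signum (suc _) = 1

support : List ℕ → ℕ
support xs = sum (map signum xs)

support-≈ : ∀ {xs ys} → xs ≈ ys → support xs ≡ support ys
support-≈ e = sum-≈ (map-≈ refl e)

support-⌊/2⌋-splitEvens : ∀ n z → support (map ⌊_/2⌋ (splitEvens n z)) ≡ support (odds z)
support-⌊/2⌋-splitEvens n z =
  support-≈ (⌊/2⌋-addTwice (glaisher n (evens z)) (odds z) (glaisher-bits n (evens z)))

support-odds-mergePairs : ∀ n z → support (odds (mergePairs n z)) ≡ support (map ⌊_/2⌋ z)
support-odds-mergePairs n z =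
  support-≈ (odds-interleave (glaisher⁻¹ n (map (_% 2) z)) (map ⌊_/2⌋ z))

-- Partitions and multiplicity sequences

Positive : List ℕ → Set
Positive = All (0 <_)

fromMultiplicities : List ℕ → List ℕ
fromMultiplicities = foldr (λ m ps → map suc ps ++ replicate m 1) []

shift-positive : ∀ ps m → Positive (map suc ps ++ replicate m 1)
shift-positive []       zero    = []
shift-positive []       (suc m) = s≤s z≤n ∷ shift-positive [] m
shift-positive (p ∷ ps) m       = s≤s z≤n ∷ shift-positive ps m

fromMultiplicities-positive : ∀ xs → Positive (fromMultiplicities xs)
fromMultiplicities-positive []       = []
fromMultiplicities-positive (x ∷ xs) = shift-positive (fromMultiplicities xs) x

replicate-decreasing : ∀ m → Linked _≥_ (replicate m 1)
replicate-decreasing zero          = []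
replicate-decreasing (suc zero)    = [-]
replicate-decreasing (suc (suc m)) = ≤-refl ∷ replicate-decreasing (suc m)

shift-decreasing : ∀ ps m → Linked _≥_ ps → Linked _≥_ (map suc ps ++ replicate m 1)
shift-decreasing []           m       _       = replicate-decreasing m
shift-decreasing (p ∷ [])     zero    _       = [-]
shift-decreasing (p ∷ [])     (suc m) _       = s≤s z≤n ∷ replicate-decreasing (suc m)
shift-decreasing (p ∷ q ∷ ps) m       (r ∷ l) = s≤s r ∷ shift-decreasing (q ∷ ps) m l

fromMultiplicities-decreasing : ∀ xs → Linked _≥_ (fromMultiplicities xs)
fromMultiplicities-decreasing []       = []
fromMultiplicities-decreasing (x ∷ xs) =
  shift-decreasing (fromMultiplicities xs) x (fromMultiplicities-decreasing xs)

sum-map-suc : ∀ ps → sum (map suc ps) ≡ sum ps + length ps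
sum-map-suc []       = refl
sum-map-suc (p ∷ ps) = trans (cong (suc p +_) (sum-map-suc ps)) (regroup p (sum ps) (length ps))
  where
  regroup : ∀ a s l → suc a + (s + l) ≡ a + s + suc l
  regroup = solve-∀

sum-replicate-1 : ∀ m → sum (replicate m 1) ≡ m
sum-replicate-1 zero    = refl
sum-replicate-1 (suc m) = cong suc (sum-replicate-1 m)

length-fromMultiplicities : ∀ xs → length (fromMultiplicities xs) ≡ sum xs
length-fromMultiplicities []       = refl
length-fromMultiplicities (x ∷ xs) = begin
  length (map suc ps ++ replicate x 1)  ≡⟨ length-++ (map suc ps) ⟩
  length (map suc ps) + length (replicate x 1)
    ≡⟨ cong₂ _+_ (trans (length-map suc ps) (length-fromMultiplicities xs)) (length-replicate x) ⟩
  sum xs + x                            ≡⟨ +-comm (sum xs) x ⟩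
  x + sum xs                            ∎
  where
  open ≡-Reasoning
  ps = fromMultiplicities xs

sum-fromMultiplicities : ∀ xs → sum (fromMultiplicities xs) ≡ size xs
sum-fromMultiplicities []       = refl
sum-fromMultiplicities (x ∷ xs) = begin
  sum (map suc ps ++ replicate x 1)          ≡⟨ sum-++ (map suc ps) (replicate x 1) ⟩
  sum (map suc ps) + sum (replicate x 1)     ≡⟨ cong₂ _+_ (sum-map-suc ps) (sum-replicate-1 x) ⟩
  sum ps + length ps + x
    ≡⟨ cong (_+ x) (cong₂ _+_ (sum-fromMultiplicities xs) (length-fromMultiplicities xs)) ⟩
  size xs + sum xs + x                       ≡⟨ +-comm _ x ⟩
  x + (size xs + sum xs)                     ≡⟨ cong₂ _+_ (*-identityˡ x) (weighted-suc 1 1 xs) ⟨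
  1 * x + weighted 2 1 xs                    ∎
  where
  open ≡-Reasoning
  ps = fromMultiplicities xs

fromMultiplicities-≈ : ∀ {xs ys} → xs ≈ ys → fromMultiplicities xs ≡ fromMultiplicities ys
fromMultiplicities-≈ = foldr-≈ (λ m ps → map suc ps ++ replicate m 1) refl

shift-injective : ∀ ps qs m m′ → Positive ps → Positive qs →
                  map suc ps ++ replicate m 1 ≡ map suc qs ++ replicate m′ 1 → ps ≡ qs × m ≡ m′
shift-injective []       []       m       m′       _         _         e =
  refl , trans (sym (length-replicate m)) (trans (cong length e) (length-replicate m′))
shift-injective []       (q ∷ qs) zero    m′       _         _         ()
shift-injective []       (q ∷ qs) (suc m) m′       _         (0<q ∷ _) e
  with () ← <⇒≢ 0<q (suc-injective (proj₁ (∷-injective e)))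
shift-injective (p ∷ ps) []       m       zero     _         _         ()
shift-injective (p ∷ ps) []       m       (suc m′) (0<p ∷ _) _         e
  with () ← <⇒≢ 0<p (sym (suc-injective (proj₁ (∷-injective e))))
shift-injective (p ∷ ps) (q ∷ qs) m       m′       (_ ∷ pps) (_ ∷ pqs) e
  with p≡q , e′ ← ∷-injective e
  with refl , refl ← shift-injective ps qs m m′ pps pqs e′
  = cong (_∷ ps) (suc-injective p≡q) , refl

fromMultiplicities-injective : ∀ xs ys → fromMultiplicities xs ≡ fromMultiplicities ys → xs ≈ ys
fromMultiplicities-injective []       []       e = ≈-refl
fromMultiplicities-injective []       (y ∷ ys) e
  with ps≡ , m≡ ← shift-injective [] (fromMultiplicities ys) 0 y [] (fromMultiplicities-positive ys) e
  = []≈∷ m≡ (fromMultiplicities-injective [] ys ps≡)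
fromMultiplicities-injective (x ∷ xs) []       e
  with ps≡ , m≡ ← shift-injective (fromMultiplicities xs) [] x 0 (fromMultiplicities-positive xs) [] e
  = ≈-sym ([]≈∷ (sym m≡) (fromMultiplicities-injective [] xs (sym ps≡)))
fromMultiplicities-injective (x ∷ xs) (y ∷ ys) e
  with ps≡ , m≡ ← shift-injective (fromMultiplicities xs) (fromMultiplicities ys) x y
                    (fromMultiplicities-positive xs) (fromMultiplicities-positive ys) e
  = ∷-≈ m≡ (fromMultiplicities-injective xs ys ps≡)

bump : ℕ → List ℕ → List ℕ
bump zero    []       = 1 ∷ []
bump zero    (x ∷ xs) = suc x ∷ xs
bump (suc p) []       = 0 ∷ bump p []
bump (suc p) (x ∷ xs) = x ∷ bump p xs

toMultiplicities : List ℕ → List ℕ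
toMultiplicities = foldr (bump ∘ pred) []

fromMultiplicities-bump : ∀ p xs → All (_≤ suc p) (fromMultiplicities xs) →
                          fromMultiplicities (bump p xs) ≡ suc p ∷ fromMultiplicities xs
fromMultiplicities-bump zero    []       _ = refl
fromMultiplicities-bump zero    (x ∷ xs) h with fromMultiplicities xs | fromMultiplicities-positive xs
... | []    | _         = refl
... | q ∷ _ | (0<q ∷ _) with s≤s q≤0 ∷ _ ← h = contradiction q≤0 (<⇒≱ 0<q)
fromMultiplicities-bump (suc p) []       _ = cong (λ ps → map suc ps ++ []) (fromMultiplicities-bump p [] [])
fromMultiplicities-bump (suc p) (x ∷ xs) h =
  cong (λ ps → map suc ps ++ replicate x 1)
       (fromMultiplicities-bump p xs (All.map s≤s⁻¹ (map⁻ (++⁻ˡ (map suc (fromMultiplicities xs)) h))))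

decreasing⇒bounded : ∀ {k ps} → Linked _≥_ (k ∷ ps) → All (_≤ k) ps
decreasing⇒bounded [-]       = []
decreasing⇒bounded (k≥p ∷ l) = Linked⇒All (flip ≤-trans) k≥p l

fromMultiplicities-toMultiplicities : ∀ ps → Linked _≥_ ps → Positive ps →
                                      fromMultiplicities (toMultiplicities ps) ≡ ps
fromMultiplicities-toMultiplicities []            _ _           = refl
fromMultiplicities-toMultiplicities (suc k ∷ ps) l (_ ∷ pos) = begin
  fromMultiplicities (bump k (toMultiplicities ps))
    ≡⟨ fromMultiplicities-bump k _ (subst (All (_≤ suc k)) (sym ih) (decreasing⇒bounded l)) ⟩
  suc k ∷ fromMultiplicities (toMultiplicities ps)
    ≡⟨ cong (suc k ∷_) ih ⟩
  suc k ∷ ps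
    ∎
  where
  open ≡-Reasoning
  ih = fromMultiplicities-toMultiplicities ps (Linked.tail l) pos

filter-map : ∀ {p q} {P : Pred ℕ p} {Q : Pred ℕ q} (P? : Decidable P) (Q? : Decidable Q)
             (f : ℕ → ℕ) {xs} →
             All (λ x → does (P? (f x)) ≡ does (Q? x)) xs → filter P? (map f xs) ≡ map f (filter Q? xs)
filter-map P? Q? f {[]}     []         = refl
filter-map P? Q? f {x ∷ xs} (eq ∷ eqs) with does (P? (f x)) | does (Q? x) | eq
... | true  | true  | _ = cong (f x ∷_) (filter-map P? Q? f eqs)
... | false | false | _ = filter-map P? Q? f eqs

distinctParts-ones : ∀ m → distinctParts (replicate (suc m) 1) ≡ 1 ∷ []
distinctParts-ones zero    = refl
distinctParts-ones (suc m) = cong (λ ds → 1 ∷ filter (¬? ∘ (1 ≟_)) ds) (distinctParts-ones m)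

distinctParts-shift : ∀ ps m → Positive ps →
  distinctParts (map suc ps ++ replicate m 1) ≡ map suc (distinctParts ps) ++ distinctParts (replicate m 1)
distinctParts-shift []           m _         = refl
distinctParts-shift (suc d ∷ ps) m (_ ∷ pos) = cong (suc (suc d) ∷_) (begin
  filter Q (distinctParts (map suc ps ++ replicate m 1))
    ≡⟨ cong (filter Q) (distinctParts-shift ps m pos) ⟩
  filter Q (map suc (distinctParts ps) ++ distinctParts (replicate m 1))
    ≡⟨ filter-++ Q (map suc (distinctParts ps)) _ ⟩
  filter Q (map suc (distinctParts ps)) ++ filter Q (distinctParts (replicate m 1))
    ≡⟨ cong₂ _++_ (filter-map Q Q′ suc (All.universal (λ _ → refl) (distinctParts ps)))
                  (keeps-ones m) ⟩
  map suc (filter Q′ (distinctParts ps)) ++ distinctParts (replicate m 1)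
    ∎)
  where
  open ≡-Reasoning
  Q  = ¬? ∘ (suc (suc d) ≟_)
  Q′ = ¬? ∘ (suc d ≟_)
  keeps-ones : ∀ m → filter Q (distinctParts (replicate m 1)) ≡ distinctParts (replicate m 1)
  keeps-ones zero    = refl
  keeps-ones (suc m) = trans (cong (filter Q) (distinctParts-ones m)) (sym (distinctParts-ones m))

multiplicity-shift : ∀ k ps m → 0 < k →
                     multiplicity (suc k) (map suc ps ++ replicate m 1) ≡ multiplicity k ps
multiplicity-shift (suc k) ps m _ = begin
  length (filter (suc (suc k) ≟_) (map suc ps ++ replicate m 1))
    ≡⟨ cong length (filter-++ (suc (suc k) ≟_) (map suc ps) _) ⟩
  length (filter (suc (suc k) ≟_) (map suc ps) ++ filter (suc (suc k) ≟_) (replicate m 1))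
    ≡⟨ cong (λ r → length (filter (suc (suc k) ≟_) (map suc ps) ++ r))
            (filter-none (suc (suc k) ≟_) (replicate⁺ m λ ())) ⟩
  length (filter (suc (suc k) ≟_) (map suc ps) ++ [])
    ≡⟨ cong length (++-identityʳ (filter (suc (suc k) ≟_) (map suc ps))) ⟩
  length (filter (suc (suc k) ≟_) (map suc ps))
    ≡⟨ cong length (filter-map (suc (suc k) ≟_) (suc k ≟_) suc (All.universal (λ _ → refl) ps)) ⟩
  length (map suc (filter (suc k ≟_) ps))
    ≡⟨ length-map suc (filter (suc k ≟_) ps) ⟩
  multiplicity (suc k) ps
    ∎
  where open ≡-Reasoning

multiplicity-ones : ∀ ps m → Positive ps → multiplicity 1 (map suc ps ++ replicate m 1) ≡ m
multiplicity-ones ps m pos = begin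
  length (filter (1 ≟_) (map suc ps ++ replicate m 1))
    ≡⟨ cong length (filter-++ (1 ≟_) (map suc ps) _) ⟩
  length (filter (1 ≟_) (map suc ps) ++ filter (1 ≟_) (replicate m 1))
    ≡⟨ cong₂ (λ l r → length (l ++ r)) (filter-none (1 ≟_) (no-ones pos))
                                       (filter-all (1 ≟_) (replicate⁺ m refl)) ⟩
  length (replicate m 1)
    ≡⟨ length-replicate m ⟩
  m
    ∎
  where
  open ≡-Reasoning
  no-ones : ∀ {ps} → Positive ps → All (1 ≢_) (map suc ps)
  no-ones []            = []
  no-ones (s≤s _ ∷ pos) = (λ ()) ∷ no-ones pos

length-filter-[x] : ∀ {p} {P : Pred ℕ p} (P? : Decidable P) x →
                    length (filter P? (x ∷ [])) ≡ (if does (P? x) then 1 else 0)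
length-filter-[x] P? x with does (P? x)
... | true  = refl
... | false = refl

-- The number of sizes k = i + 1 with zᵢ > 0 and p k zᵢ.
countSizes : (ℕ → ℕ → Bool) → List ℕ → ℕ
countSizes p []       = 0
countSizes p (x ∷ xs) = countSizes (λ k → p (suc k)) xs + (if p 1 x then signum x else 0)

length-filter-distinctParts : ∀ {ℓ} {P : ℕ → ℕ → Set ℓ} (P? : ∀ k m → Dec (P k m)) z →
  length (filter (λ k → P? k (multiplicity k (fromMultiplicities z))) (distinctParts (fromMultiplicities z)))
  ≡ countSizes (λ k m → does (P? k m)) z
length-filter-distinctParts P? []       = refl
length-filter-distinctParts {P = P} P? (x ∷ xs) = begin
  length (filter Q (distinctParts (map suc ps ++ replicate x 1)))
    ≡⟨ cong (length ∘ filter Q) (distinctParts-shift ps x pos) ⟩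
  length (filter Q (map suc (distinctParts ps) ++ distinctParts (replicate x 1)))
    ≡⟨ cong length (filter-++ Q (map suc (distinctParts ps)) _) ⟩
  length (filter Q (map suc (distinctParts ps)) ++ filter Q (distinctParts (replicate x 1)))
    ≡⟨ length-++ (filter Q (map suc (distinctParts ps))) ⟩
  length (filter Q (map suc (distinctParts ps))) + length (filter Q (distinctParts (replicate x 1)))
    ≡⟨ cong₂ _+_ shifted (ones x refl) ⟩
  countSizes (λ k m → does (P? (suc k) m)) xs + (if does (P? 1 x) then signum x else 0)
    ∎
  where
  open ≡-Reasoning
  ps  = fromMultiplicities xs
  pos = fromMultiplicities-positive xs
  Q : ∀ k → Dec (P k (multiplicity k (map suc ps ++ replicate x 1)))
  Q k = P? k (multiplicity k (map suc ps ++ replicate x 1))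
  Q′ : ∀ k → Dec (P (suc k) (multiplicity k ps))
  Q′ k = P? (suc k) (multiplicity k ps)
  Q≡Q′ : ∀ {k} → 0 < k → does (Q (suc k)) ≡ does (Q′ k)
  Q≡Q′ {k} 0<k = cong (λ m → does (P? (suc k) m)) (multiplicity-shift k ps x 0<k)
  shifted : length (filter Q (map suc (distinctParts ps))) ≡ countSizes (λ k m → does (P? (suc k) m)) xs
  shifted = begin
    length (filter Q (map suc (distinctParts ps)))
      ≡⟨ cong length (filter-map Q Q′ suc (All.map Q≡Q′ (deduplicate⁺ _≟_ pos))) ⟩
    length (map suc (filter Q′ (distinctParts ps)))
      ≡⟨ length-map suc (filter Q′ (distinctParts ps)) ⟩
    length (filter Q′ (distinctParts ps))
      ≡⟨ length-filter-distinctParts (λ k → P? (suc k)) xs ⟩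
    countSizes (λ k m → does (P? (suc k) m)) xs
      ∎
  ones : ∀ y → y ≡ x →
         length (filter Q (distinctParts (replicate y 1))) ≡ (if does (P? 1 x) then signum x else 0)
  ones zero refl with does (P? 1 0)
  ... | true  = refl
  ... | false = refl
  ones (suc y) refl = begin
    length (filter Q (distinctParts (replicate (suc y) 1)))
      ≡⟨ cong (length ∘ filter Q) (distinctParts-ones y) ⟩
    length (filter Q (1 ∷ []))
      ≡⟨ length-filter-[x] Q 1 ⟩
    (if does (Q 1) then 1 else 0)
      ≡⟨ cong (λ m → if does (P? 1 m) then 1 else 0) (multiplicity-ones ps (suc y) pos) ⟩
    (if does (P? 1 (suc y)) then 1 else 0)
      ∎

countSizes-even : ∀ z → countSizes (λ k _ → does (k % 2 ≟ 0)) z ≡ support (odds z)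
countSizes-odd  : ∀ z → countSizes (λ k _ → does (suc k % 2 ≟ 0)) z ≡ support (evens z)
countSizes-even []       = refl
countSizes-even (x ∷ xs) = trans (+-identityʳ _) (countSizes-odd xs)
countSizes-odd  []       = refl
countSizes-odd  (x ∷ xs) = trans (cong (_+ signum x) (countSizes-even xs)) (+-comm _ (signum x))

countSizes-repeated : ∀ z → countSizes (λ _ m → does (m ≥? 2)) z ≡ support (map ⌊_/2⌋ z)
countSizes-repeated []       = refl
countSizes-repeated (x ∷ xs) =
  trans (cong₂ _+_ (countSizes-repeated xs) (repeated x)) (+-comm _ (signum ⌊ x /2⌋))
  where
  repeated : ∀ x → (if does (x ≥? 2) then signum x else 0) ≡ signum ⌊ x /2⌋
  repeated zero          = refl
  repeated (suc zero)    = refl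
  repeated (suc (suc x)) = refl

Partition-≡ : ∀ {n} {π π′ : Partition n} → parts π ≡ parts π′ → π ≡ π′
Partition-≡ {π = mkPartition ps d p s} {mkPartition .ps d′ p′ s′} refl
  rewrite Linked.irrelevant ≤-irrelevant d d′ | All.irrelevant ≤-irrelevant p p′ | ≡-irrelevant s s′
  = refl

module _ {n : ℕ} where

  multiplicities : Partition n → List ℕ
  multiplicities π = toMultiplicities (parts π)

  fromMultiplicities-multiplicities : ∀ π → fromMultiplicities (multiplicities π) ≡ parts π
  fromMultiplicities-multiplicities π =
    fromMultiplicities-toMultiplicities (parts π) (decreasing π) (positive π)

  size-multiplicities : ∀ π → size (multiplicities π) ≡ n
  size-multiplicities π = begin
    size (multiplicities π)                     ≡⟨ sum-fromMultiplicities (multiplicities π) ⟨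
    sum (fromMultiplicities (multiplicities π)) ≡⟨ cong sum (fromMultiplicities-multiplicities π) ⟩
    sum (parts π)                               ≡⟨ sums π ⟩
    n                                           ∎
    where open ≡-Reasoning

  partition : (z : List ℕ) → size z ≡ n → Partition n
  partition z e = mkPartition (fromMultiplicities z) (fromMultiplicities-decreasing z)
                              (fromMultiplicities-positive z) (trans (sum-fromMultiplicities z) e)

  partition-multiplicities : ∀ π e → partition (multiplicities π) e ≡ π
  partition-multiplicities π _ = Partition-≡ (fromMultiplicities-multiplicities π)

  multiplicities-partition : ∀ z e → multiplicities (partition z e) ≈ z
  multiplicities-partition z e = fromMultiplicities-injective _ z
    (fromMultiplicities-multiplicities (partition z e))

  partition-≈ : ∀ {z z′} e e′ → z ≈ z′ → partition z e ≡ partition z′ e′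
  partition-≈ e e′ z≈z′ = Partition-≡ (fromMultiplicities-≈ z≈z′)

  X-partition : ∀ z e → X (partition z e) ≡ support (odds z)
  X-partition z _ = trans (length-filter-distinctParts (λ k _ → k % 2 ≟ 0) z) (countSizes-even z)

  Y-partition : ∀ z e → Y (partition z e) ≡ support (map ⌊_/2⌋ z)
  Y-partition z _ = trans (length-filter-distinctParts (λ _ m → m ≥? 2) z) (countSizes-repeated z)

  X-multiplicities : ∀ π → X π ≡ support (odds (multiplicities π))
  X-multiplicities π = trans (cong X (sym (partition-multiplicities π (size-multiplicities π))))
                             (X-partition (multiplicities π) (size-multiplicities π))

  Y-multiplicities : ∀ π → Y π ≡ support (map ⌊_/2⌋ (multiplicities π))
  Y-multiplicities π = trans (cong Y (sym (partition-multiplicities π (size-multiplicities π))))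
                             (Y-partition (multiplicities π) (size-multiplicities π))

  partition-roundtrip : (F G : List ℕ → List ℕ) → (∀ {z z′} → z ≈ z′ → F z ≈ F z′) →
                        ∀ π e {e′} → F (G (multiplicities π)) ≈ multiplicities π →
                        partition (F (multiplicities (partition (G (multiplicities π)) e))) e′ ≡ π
  partition-roundtrip F G F-≈ π e {e′} FG≈ =
    trans (partition-≈ e′ (size-multiplicities π) (≈-trans (F-≈ (multiplicities-partition _ e)) FG≈))
          (partition-multiplicities π _)

module _ (n j : ℕ) where

  evenToRepeated : Σ (Partition n) (λ π → X π ≡ j) → Σ (Partition n) (λ π → Y π ≡ j)
  evenToRepeated (π , Xπ≡j) = partition (splitEvens n z) e , (begin
    Y (partition (splitEvens n z) e)    ≡⟨ Y-partition (splitEvens n z) e ⟩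
    support (map ⌊_/2⌋ (splitEvens n z)) ≡⟨ support-⌊/2⌋-splitEvens n z ⟩
    support (odds z)                     ≡⟨ X-multiplicities π ⟨
    X π                                  ≡⟨ Xπ≡j ⟩
    j                                    ∎)
    where
    open ≡-Reasoning
    z = multiplicities π
    e = size-splitEvens n z (size-multiplicities π)

  repeatedToEven : Σ (Partition n) (λ π → Y π ≡ j) → Σ (Partition n) (λ π → X π ≡ j)
  repeatedToEven (π , Yπ≡j) = partition (mergePairs n z) e , (begin
    X (partition (mergePairs n z) e)    ≡⟨ X-partition (mergePairs n z) e ⟩
    support (odds (mergePairs n z))     ≡⟨ support-odds-mergePairs n z ⟩
    support (map ⌊_/2⌋ z)                ≡⟨ Y-multiplicities π ⟨
    Y π                                  ≡⟨ Yπ≡j ⟩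
    j                                    ∎)
    where
    open ≡-Reasoning
    z = multiplicities π
    e = size-mergePairs n z (size-multiplicities π)

  evenToRepeated-repeatedToEven : ∀ σ → evenToRepeated (repeatedToEven σ) ≡ σ
  evenToRepeated-repeatedToEven (π , _) = Σ-≡,≡→≡
    ( partition-roundtrip (splitEvens n) (mergePairs n) (splitEvens-≈ n) π
        (size-mergePairs n (multiplicities π) (size-multiplicities π))
        (splitEvens-mergePairs n (multiplicities π) (≤-reflexive (size-multiplicities π)))
    , ≡-irrelevant _ _)

  repeatedToEven-evenToRepeated : ∀ σ → repeatedToEven (evenToRepeated σ) ≡ σ
  repeatedToEven-evenToRepeated (π , _) = Σ-≡,≡→≡
    ( partition-roundtrip (mergePairs n) (splitEvens n) (mergePairs-≈ n) π
        (size-splitEvens n (multiplicities π) (size-multiplicities π))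
        (mergePairs-splitEvens n (multiplicities π) (≤-reflexive (size-multiplicities π)))
    , ≡-irrelevant _ _)

theorem1 : (n : ℕ) → .{{_ : NonZero n}} → (j : ℕ) →
           (Σ (Partition n) (λ π → X π ≡ j)) ↔ (Σ (Partition n) (λ π → Y π ≡ j))
theorem1 n j = mk↔ₛ′ (evenToRepeated n j) (repeatedToEven n j)
                     (evenToRepeated-repeatedToEven n j) (repeatedToEven-evenToRepeated n j)
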